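{- Let $T$ be a tournament and let $uv\in E(T)$. Define $X=N^-(u)\cap N^-(v)$, $Y=N^-(u)\cap N^+(v)$, $Z=N^+(u)\cap N^+(v)$, and $W=N^+(u)\cap N^-(v)$. Then $uv$ is a bridge if and only if all of the following hold: (B1) $W=\emptyset$; (B2) for each $(P,Q)\in\{(X,Y\cup Z),(X\cup Y,Z)\}$, there is no vertex of $P$ with at least two distinct in-neighbours in $Q$; (B3) for each $(P,Q)\in\{(X,Y\cup Z),(X\cup Y,Z)\}$, there is no vertex of $Q$ with at least two distinct out-neighbours in $P$.
   Context: Tournaments are finite; $uv\in E(T)$ means the edge is directed from $u$ to $v$; $N^+(w)$ and $N^-(w)$ are the sets of out-neighbours and in-neighbours of $w$. For an ordering $\sigma=(v_1,\dots,v_n)$ of $V(T)$, the backedge graph $B_\sigma(T)$ is the undirected graph on $V(T)$ with edges $v_iv_j$ for $i>j$ and $v_iv_j\in E(T)$. An edge $uv\in E(T)$ is a bridge if there is an ordering $\sigma=(v_1,\dots,v_n)$ with $u=v_i$, $v=v_j$ and $i>j$ such that $uv$ is an isolated edge of $B_\sigma(T)$ (both $u$ and $v$ have degree $1$), the edges of $B_\sigma(T)$ between $\{v_s:s<i\}$ and $\{v_t:t>i\}$ form a matching, and the edges of $B_\sigma(T)$ between $\{v_s:s<j\}$ and $\{v_t:t>j\}$ form a matching. -}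

module Defs where

open import Data.Nat using (ℕ)
open import Data.Fin using (Fin; _<_)
open import Data.Bool using (Bool; true; false; not)
open import Data.Product using (_×_; Σ; ∃; ∃-syntax)
open import Data.Sum using (_⊎_)
open import Relation.Nullary using (¬_)
open import Relation.Binary.PropositionalEquality using (_≡_; _≢_)
open import Function.Definitions using (Injective)

-- A tournament on vertex set Fin n, given by a Boolean adjacency matrix:
-- adj u v ≡ true means the edge between u and v is directed from u to v.
record Tournament (n : ℕ) : Set where
  field
    adj       : Fin n → Fin n → Bool
    loopless  : ∀ u → adj u u ≡ false
    tourn     : ∀ u v → u ≢ v → adj u v ≡ not (adj v u)

module _ {n : ℕ} (T : Tournament n) where
  open Tournament T

  E : Fin n → Fin n → Set
  E u v = adj u v ≡ true

  -- An ordering σ = (v_1,…,v_n) of V(T), recorded by the position of each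
  -- vertex: pos w = i  iff  w = v_i.  An injective map Fin n → Fin n is a
  -- bijection, so this is exactly an ordering.
  record Ordering : Set where
    field
      pos    : Fin n → Fin n
      posInj : Injective _≡_ _≡_ pos
  open Ordering public

  -- Undirected edge ab of the backedge graph B_σ(T): the later vertex
  -- has an edge of T to the earlier one.
  Back : Ordering → Fin n → Fin n → Set
  Back σ a b = (pos σ b < pos σ a × E a b) ⊎ (pos σ a < pos σ b × E b a)

  Cross : Ordering → Fin n → Fin n → Fin n → Set
  Cross σ k a b = pos σ a < k × k < pos σ b × Back σ a b

  CutMatching : Ordering → Fin n → Set
  CutMatching σ k =
    (∀ a b c → Cross σ k a b → Cross σ k a c → b ≡ c) ×
    (∀ a b c → Cross σ k a c → Cross σ k b c → a ≡ b)

  IsBridge : Fin n → Fin n → Set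
  IsBridge u v = ∃[ σ ]
    ( pos σ v < pos σ u
    × Back σ u v
    × (∀ w → Back σ u w → w ≡ v)
    × (∀ w → Back σ v w → w ≡ u)
    × CutMatching σ (pos σ u)
    × CutMatching σ (pos σ v) )

  VSet : Set₁
  VSet = Fin n → Set

  _∪_ : VSet → VSet → VSet
  (P ∪ Q) w = P w ⊎ Q w

  Xs Ys Zs Ws : Fin n → Fin n → VSet
  Xs u v w = E w u × E w v
  Ys u v w = E w u × E v w
  Zs u v w = E u w × E v w
  Ws u v w = E u w × E w v

  NoTwoIn : VSet → VSet → Set
  NoTwoIn P Q = ¬ (∃[ p ] ∃[ q₁ ] ∃[ q₂ ]
    (P p × Q q₁ × Q q₂ × q₁ ≢ q₂ × E q₁ p × E q₂ p))

  NoTwoOut : VSet → VSet → Set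
  NoTwoOut P Q = ¬ (∃[ q ] ∃[ p₁ ] ∃[ p₂ ]
    (Q q × P p₁ × P p₂ × p₁ ≢ p₂ × E q p₁ × E q p₂))

  B1 : Fin n → Fin n → Set
  B1 u v = ∀ w → ¬ Ws u v w

  B2 : Fin n → Fin n → Set
  B2 u v = NoTwoIn (Xs u v) (Ys u v ∪ Zs u v) × NoTwoIn (Xs u v ∪ Ys u v) (Zs u v)

  B3 : Fin n → Fin n → Set
  B3 u v = NoTwoOut (Xs u v) (Ys u v ∪ Zs u v) × NoTwoOut (Xs u v ∪ Ys u v) (Zs u v)

-- In a bridge ordering σ every edge at u or v other than uv points forward. This
-- forces X before v, Y between v and u, Z after u, and leaves no room for W; the
-- backedges crossing the cut at v are then exactly the edges from Y ∪ Z to X, and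
-- those crossing the cut at u exactly the edges from Z to X ∪ Y, so the two
-- matching conditions say precisely B2 and B3. Conversely, under B1 the sets X, {v},
-- Y, {u}, Z partition the vertices, and listing them in this order (each block in
-- any order) is a bridge ordering.
module Submission where

open import Defs
open import Data.Nat using (ℕ)
open import Data.Fin using (Fin)
open import Data.Product using (_×_)
open import Function.Bundles using (_⇔_)

open import Data.Bool.Base using (true; false; not)
open import Data.Bool.Properties using (T-≡; not-¬)
open import Data.Fin.Base using (_<_; fromℕ<; toℕ; combine)
open import Data.Fin.Patterns using (0F; 1F; 2F; 3F; 4F)
open import Data.Fin.Properties
  using (_≟_; _<?_; <-cmp; <-irrefl; <-asym; <-trans; <⇒≢; toℕ-fromℕ<
        ; combine-monoˡ-<; combine-injectiveʳ)
open import Data.Fin.Subset using (Subset; _∈_; _∉_; _⊂_; ⊤; ∣_∣)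
open import Data.Fin.Subset.Properties using (∈⊤; ∣⊤∣≡n; p⊂q⇒∣p∣<∣q∣)
import Data.Nat.Base as ℕ
open import Data.Product using (_,_; proj₁; proj₂)
open import Data.Sum using (_⊎_; inj₁; inj₂; [_,_]; swap)
open import Data.Vec.Base using (tabulate)
open import Data.Vec.Properties using (lookup∘tabulate; lookup⇒[]=; []=⇒lookup)
open import Function.Base using (_∘_)
open import Function.Bundles using (Equivalence; mk⇔)
open import Function.Definitions using (Injective)
open import Relation.Binary.Definitions using (tri<; tri≈; tri>)
open import Relation.Binary.PropositionalEquality
  using (_≡_; _≢_; refl; sym; trans; cong; subst; subst₂; ≢-sym
        ; ≡-≟-identity; ≢-≟-identity)
open import Relation.Nullary using (¬_; yes; no; contradiction)
open import Relation.Nullary.Decidable using (⌊_⌋; toWitness; fromWitness; decidable-stable)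

module _ {n : ℕ} (T : Tournament n) where
  open Tournament T

  E-irrefl : ∀ {a} → ¬ E T a a
  E-irrefl {a} = not-¬ (loopless a)

  E⇒≢ : ∀ {a b} → E T a b → a ≢ b
  E⇒≢ ab refl = E-irrefl ab

  E-asym : ∀ {a b} → E T a b → ¬ E T b a
  E-asym {a} {b} ab ba = not-¬ ab (trans (tourn a b (E⇒≢ ab)) (cong not ba))

  E⇒reverse-false : ∀ {a b} → E T a b → adj b a ≡ false
  E⇒reverse-false {a} {b} ab = trans (tourn b a (≢-sym (E⇒≢ ab))) (cong not ab)

  E-total : ∀ {a b} → a ≢ b → E T a b ⊎ E T b a
  E-total {a} {b} a≢b with adj b a | tourn a b a≢b
  ... | true  | _  = inj₂ refl
  ... | false | ab = inj₁ ab

module _ {n m : ℕ} (key : Fin n → Fin m) where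

  below : Fin n → Subset n
  below w = tabulate (λ x → ⌊ key x <? key w ⌋)

  ∈below : ∀ {x w} → key x < key w → x ∈ below w
  ∈below {x} {w} x<w =
    lookup⇒[]= x (below w)
      (trans (lookup∘tabulate _ x) (Equivalence.to T-≡ (fromWitness x<w)))

  ∈below⁻¹ : ∀ {x w} → x ∈ below w → key x < key w
  ∈below⁻¹ {x} {w} x∈ =
    toWitness (Equivalence.from T-≡ (trans (sym (lookup∘tabulate _ x)) ([]=⇒lookup x∈)))

  ∉below-self : ∀ w → w ∉ below w
  ∉below-self w w∈ = <-irrefl refl (∈below⁻¹ w∈)

  below-⊂ : ∀ {a b} → key a < key b → below a ⊂ below b
  below-⊂ {a} a<b =
    (λ x∈ → ∈below (<-trans (∈below⁻¹ x∈) a<b)) , a , ∈below a<b , ∉below-self a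

  below-⊂⊤ : ∀ w → below w ⊂ ⊤
  below-⊂⊤ w = (λ _ → ∈⊤) , w , ∈⊤ , ∉below-self w

  rank : Fin n → Fin n
  rank w = fromℕ< (subst (∣ below w ∣ ℕ.<_) (∣⊤∣≡n n) (p⊂q⇒∣p∣<∣q∣ (below-⊂⊤ w)))

  toℕ-rank : ∀ w → toℕ (rank w) ≡ ∣ below w ∣
  toℕ-rank w = toℕ-fromℕ< _

  rank-mono : ∀ {a b} → key a < key b → rank a < rank b
  rank-mono {a} {b} a<b =
    subst₂ ℕ._<_ (sym (toℕ-rank a)) (sym (toℕ-rank b)) (p⊂q⇒∣p∣<∣q∣ (below-⊂ a<b))

  rank-injective : Injective _≡_ _≡_ key → Injective _≡_ _≡_ rank
  rank-injective key-injective {a} {b} ra≡rb with <-cmp (key a) (key b)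
  ... | tri< a<b _ _   = contradiction ra≡rb (<⇒≢ (rank-mono a<b))
  ... | tri≈ _ ka≡kb _ = key-injective ka≡kb
  ... | tri> _ _ b<a   = contradiction (sym ra≡rb) (<⇒≢ (rank-mono b<a))

module _ {n k : ℕ} (cls : Fin n → Fin k) where

  -- combine i j = i * n + j: order by class first, then by vertex.
  classKey : Fin n → Fin (k ℕ.* n)
  classKey w = combine (cls w) w

  classKey-injective : Injective _≡_ _≡_ classKey
  classKey-injective {a} {b} = combine-injectiveʳ (cls a) a (cls b) b

  classKey-mono : ∀ {a b} → cls a < cls b → classKey a < classKey b
  classKey-mono {a} {b} = combine-monoˡ-< a b

module _ {n : ℕ} (T : Tournament n) where

  orderingBy : ∀ {k} → (Fin n → Fin k) → Ordering T
  orderingBy cls = record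
    { pos    = rank (classKey cls)
    ; posInj = rank-injective (classKey cls) (classKey-injective cls)
    }

  orderingBy-mono : ∀ {k} (cls : Fin n → Fin k) {a b} →
    cls a < cls b → pos (orderingBy cls) a < pos (orderingBy cls) b
  orderingBy-mono cls a<b = rank-mono (classKey cls) (classKey-mono cls a<b)

module _ {n : ℕ} {T : Tournament n} (σ : Ordering T) where

  Back-sym : ∀ {a b} → Back T σ a b → Back T σ b a
  Back-sym = swap

  Back-irrefl : ∀ {a} → ¬ Back T σ a a
  Back-irrefl (inj₁ (a<a , _)) = <-irrefl refl a<a
  Back-irrefl (inj₂ (a<a , _)) = <-irrefl refl a<a

  forward⇒¬Back : ∀ {a b} → E T a b → pos σ a < pos σ b → ¬ Back T σ a b
  forward⇒¬Back _  a<b (inj₁ (b<a , _)) = <-asym a<b b<a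
  forward⇒¬Back ab _   (inj₂ (_ , ba))  = E-asym T ab ba

  ¬Back⇒forward : ∀ {a b} → E T a b → ¬ Back T σ a b → pos σ a < pos σ b
  ¬Back⇒forward {a} {b} ab ¬back with <-cmp (pos σ a) (pos σ b)
  ... | tri< a<b _ _   = a<b
  ... | tri≈ _ pa≡pb _ = contradiction (posInj σ pa≡pb) (E⇒≢ T ab)
  ... | tri> _ _ b<a   = contradiction (inj₁ (b<a , ab)) ¬back

  module _ {a b : Fin n} (only-b : ∀ w → Back T σ a w → w ≡ b) where

    out-neighbour-after : ∀ {w} → E T a w → w ≢ b → pos σ a < pos σ w
    out-neighbour-after aw w≢b = ¬Back⇒forward aw (w≢b ∘ only-b _)

    in-neighbour-before : ∀ {w} → E T w a → w ≢ b → pos σ w < pos σ a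
    in-neighbour-before wa w≢b = ¬Back⇒forward wa (w≢b ∘ only-b _ ∘ Back-sym)

  Cross⇒E : ∀ {k a b} → Cross T σ k a b → E T b a
  Cross⇒E (a<k , k<b , inj₁ (b<a , _)) = contradiction b<a (<-asym (<-trans a<k k<b))
  Cross⇒E (_   , _   , inj₂ (_ , ba))  = ba

  E⇒Cross : ∀ {k a b} → pos σ a < k → k < pos σ b → E T b a → Cross T σ k a b
  E⇒Cross a<k k<b ba = a<k , k<b , inj₂ (<-trans a<k k<b , ba)

  module _ {k : Fin n} {P Q : VSet T} where

    cutMatching⇒noTwo : (∀ {p q} → P p → Q q → E T q p → Cross T σ k p q) →
                        CutMatching T σ k → NoTwoIn T P Q × NoTwoOut T P Q
    cutMatching⇒noTwo cross (out-unique , in-unique) =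
        (λ (p , q₁ , q₂ , Pp , Qq₁ , Qq₂ , q₁≢q₂ , q₁p , q₂p) →
           q₁≢q₂ (out-unique p q₁ q₂ (cross Pp Qq₁ q₁p) (cross Pp Qq₂ q₂p)))
      , (λ (q , p₁ , p₂ , Qq , Pp₁ , Pp₂ , p₁≢p₂ , qp₁ , qp₂) →
           p₁≢p₂ (in-unique p₁ p₂ q (cross Pp₁ Qq qp₁) (cross Pp₂ Qq qp₂)))

    noTwo⇒cutMatching : (∀ {p q} → Cross T σ k p q → P p × Q q) →
                        NoTwoIn T P Q → NoTwoOut T P Q → CutMatching T σ k
    noTwo⇒cutMatching sides noTwoIn noTwoOut = out-unique , in-unique
      where
        out-unique : ∀ a b c → Cross T σ k a b → Cross T σ k a c → b ≡ c
        out-unique a b c ab ac = decidable-stable (b ≟ c) λ b≢c →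
          noTwoIn (a , b , c , proj₁ (sides ab) , proj₂ (sides ab) , proj₂ (sides ac) ,
                   b≢c , Cross⇒E ab , Cross⇒E ac)

        in-unique : ∀ a b c → Cross T σ k a c → Cross T σ k b c → a ≡ b
        in-unique a b c ac bc = decidable-stable (a ≟ b) λ a≢b →
          noTwoOut (c , a , b , proj₂ (sides ac) , proj₁ (sides ac) , proj₁ (sides bc) ,
                    a≢b , Cross⇒E ac , Cross⇒E bc)

module _ {n : ℕ} (T : Tournament n) (u v : Fin n) where

  private
    X Y Z X∪Y Y∪Z : VSet T
    X   = Xs T u v
    Y   = Ys T u v
    Z   = Zs T u v
    X∪Y = _∪_ T X Y
    Y∪Z = _∪_ T Y Z

  module BridgeOrdering
    (σ : Ordering T) (v<u : pos σ v < pos σ u)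
    (u-only-v : ∀ w → Back T σ u w → w ≡ v) (v-only-u : ∀ w → Back T σ v w → w ≡ u)
    where

    X-before-v : ∀ {p} → X p → pos σ p < pos σ v
    X-before-v (pu , pv) = in-neighbour-before σ v-only-u pv (E⇒≢ T pu)

    v-before-Y : ∀ {q} → Y q → pos σ v < pos σ q
    v-before-Y (qu , vq) = out-neighbour-after σ v-only-u vq (E⇒≢ T qu)

    Y-before-u : ∀ {q} → Y q → pos σ q < pos σ u
    Y-before-u (qu , vq) = in-neighbour-before σ u-only-v qu (≢-sym (E⇒≢ T vq))

    u-before-Z : ∀ {q} → Z q → pos σ u < pos σ q
    u-before-Z (uq , vq) = out-neighbour-after σ u-only-v uq (≢-sym (E⇒≢ T vq))

    no-W : B1 T u v
    no-W w (uw , wv) = <-asym v<u (<-trans u<w w<v)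
      where
        u<w : pos σ u < pos σ w
        u<w = out-neighbour-after σ u-only-v uw (E⇒≢ T wv)
        w<v : pos σ w < pos σ v
        w<v = in-neighbour-before σ v-only-u wv (≢-sym (E⇒≢ T uw))

    cross-at-v : ∀ {p q} → X p → Y∪Z q → E T q p → Cross T σ (pos σ v) p q
    cross-at-v x yz = E⇒Cross σ (X-before-v x) ([ v-before-Y , <-trans v<u ∘ u-before-Z ] yz)

    cross-at-u : ∀ {p q} → X∪Y p → Z q → E T q p → Cross T σ (pos σ u) p q
    cross-at-u xy z =
      E⇒Cross σ ([ (λ x → <-trans (X-before-v x) v<u) , Y-before-u ] xy) (u-before-Z z)

  bridge⇒conditions : IsBridge T u v → B1 T u v × B2 T u v × B3 T u v
  bridge⇒conditions (σ , v<u , _ , u-only-v , v-only-u , matching-u , matching-v) =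
    let open BridgeOrdering σ v<u u-only-v v-only-u
        in-v , out-v = cutMatching⇒noTwo σ cross-at-v matching-v
        in-u , out-u = cutMatching⇒noTwo σ cross-at-u matching-u
    in no-W , (in-v , in-u) , (out-v , out-u)

  module BlockOrdering (uv : E T u v) (no-W : B1 T u v) where
    open Tournament T using (adj)

    data Place (w : Fin n) : Set where
      in-X : X w → Place w
      is-v : w ≡ v → Place w
      in-Y : Y w → Place w
      is-u : w ≡ u → Place w
      in-Z : Z w → Place w

    place : ∀ w → Place w
    place w with w ≟ v | w ≟ u
    ... | yes w≡v | _       = is-v w≡v
    ... | no _    | yes w≡u = is-u w≡u
    ... | no w≢v  | no w≢u  with E-total T w≢v | E-total T w≢u
    ... | inj₁ wv | inj₁ wu = in-X (wu , wv)
    ... | inj₁ wv | inj₂ uw = contradiction (uw , wv) (no-W w)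
    ... | inj₂ vw | inj₁ wu = in-Y (wu , vw)
    ... | inj₂ vw | inj₂ uw = in-Z (uw , vw)

    -- Vertices of W would also get 0F; B1 says there are none.
    side : Fin n → Fin 5
    side w with w ≟ v | w ≟ u | adj w v | adj w u
    ... | yes _ | _     | _     | _     = 1F
    ... | no _  | yes _ | _     | _     = 3F
    ... | no _  | no _  | true  | _     = 0F
    ... | no _  | no _  | false | true  = 2F
    ... | no _  | no _  | false | false = 4F

    -- Rewriting the adjacencies first keeps the later rewrites, which mention
    -- the same proofs, well-typed.
    side-X : ∀ {w} → X w → side w ≡ 0F
    side-X {w} (wu , wv)
      rewrite wv | ≢-≟-identity _≟_ (E⇒≢ T wv) | ≢-≟-identity _≟_ (E⇒≢ T wu) = refl

    side-v : side v ≡ 1F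
    side-v rewrite ≡-≟-identity _≟_ {v} refl = refl

    side-Y : ∀ {w} → Y w → side w ≡ 2F
    side-Y {w} (wu , vw)
      rewrite E⇒reverse-false T vw | wu
            | ≢-≟-identity _≟_ (≢-sym (E⇒≢ T vw)) | ≢-≟-identity _≟_ (E⇒≢ T wu) = refl

    side-u : side u ≡ 3F
    side-u rewrite ≢-≟-identity _≟_ (E⇒≢ T uv) | ≡-≟-identity _≟_ {u} refl = refl

    side-Z : ∀ {w} → Z w → side w ≡ 4F
    side-Z {w} (uw , vw)
      rewrite E⇒reverse-false T vw | E⇒reverse-false T uw
            | ≢-≟-identity _≟_ (≢-sym (E⇒≢ T vw))
            | ≢-≟-identity _≟_ (≢-sym (E⇒≢ T uw)) = refl

    σ : Ordering T
    σ = orderingBy T side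

    ordered : ∀ {a b i j} → side a ≡ i → side b ≡ j → i < j → pos σ a < pos σ b
    ordered refl refl = orderingBy-mono T side

    X-before-v : ∀ {w} → X w → pos σ w < pos σ v
    X-before-v x = ordered (side-X x) side-v ℕ.z<s

    v-before-Y : ∀ {w} → Y w → pos σ v < pos σ w
    v-before-Y y = ordered side-v (side-Y y) (ℕ.s<s ℕ.z<s)

    Y-before-u : ∀ {w} → Y w → pos σ w < pos σ u
    Y-before-u y = ordered (side-Y y) side-u (ℕ.s<s (ℕ.s<s ℕ.z<s))

    u-before-Z : ∀ {w} → Z w → pos σ u < pos σ w
    u-before-Z z = ordered side-u (side-Z z) (ℕ.s<s (ℕ.s<s (ℕ.s<s ℕ.z<s)))

    v-before-u : pos σ v < pos σ u
    v-before-u = ordered side-v side-u (ℕ.s<s ℕ.z<s)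

    X-before-u : ∀ {w} → X w → pos σ w < pos σ u
    X-before-u x = <-trans (X-before-v x) v-before-u

    v-before-Z : ∀ {w} → Z w → pos σ v < pos σ w
    v-before-Z z = <-trans v-before-u (u-before-Z z)

    u-only-v : ∀ w → Back T σ u w → w ≡ v
    u-only-v w back with place w
    ... | in-X x@(wu , _) = contradiction (Back-sym σ back) (forward⇒¬Back σ wu (X-before-u x))
    ... | is-v w≡v        = w≡v
    ... | in-Y y@(wu , _) = contradiction (Back-sym σ back) (forward⇒¬Back σ wu (Y-before-u y))
    ... | is-u refl       = contradiction back (Back-irrefl σ)
    ... | in-Z z@(uw , _) = contradiction back (forward⇒¬Back σ uw (u-before-Z z))

    v-only-u : ∀ w → Back T σ v w → w ≡ u
    v-only-u w back with place w
    ... | in-X x@(_ , wv) = contradiction (Back-sym σ back) (forward⇒¬Back σ wv (X-before-v x))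
    ... | is-v refl       = contradiction back (Back-irrefl σ)
    ... | in-Y y@(_ , vw) = contradiction back (forward⇒¬Back σ vw (v-before-Y y))
    ... | is-u w≡u        = w≡u
    ... | in-Z z@(_ , vw) = contradiction back (forward⇒¬Back σ vw (v-before-Z z))

    before-v⇒X : ∀ {w} → pos σ w < pos σ v → X w
    before-v⇒X {w} w<v with place w
    ... | in-X x    = x
    ... | is-v refl = contradiction w<v (<-irrefl refl)
    ... | in-Y y    = contradiction w<v (<-asym (v-before-Y y))
    ... | is-u refl = contradiction w<v (<-asym v-before-u)
    ... | in-Z z    = contradiction w<v (<-asym (v-before-Z z))

    after-v⇒Y∪Z-or-u : ∀ {w} → pos σ v < pos σ w → Y∪Z w ⊎ w ≡ u
    after-v⇒Y∪Z-or-u {w} v<w with place w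
    ... | in-X x    = contradiction v<w (<-asym (X-before-v x))
    ... | is-v refl = contradiction v<w (<-irrefl refl)
    ... | in-Y y    = inj₁ (inj₁ y)
    ... | is-u w≡u  = inj₂ w≡u
    ... | in-Z z    = inj₁ (inj₂ z)

    before-u⇒X∪Y-or-v : ∀ {w} → pos σ w < pos σ u → X∪Y w ⊎ w ≡ v
    before-u⇒X∪Y-or-v {w} w<u with place w
    ... | in-X x    = inj₁ (inj₁ x)
    ... | is-v w≡v  = inj₂ w≡v
    ... | in-Y y    = inj₁ (inj₂ y)
    ... | is-u refl = contradiction w<u (<-irrefl refl)
    ... | in-Z z    = contradiction w<u (<-asym (u-before-Z z))

    after-u⇒Z : ∀ {w} → pos σ u < pos σ w → Z w
    after-u⇒Z {w} u<w with place w
    ... | in-X x    = contradiction u<w (<-asym (X-before-u x))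
    ... | is-v refl = contradiction u<w (<-asym v-before-u)
    ... | in-Y y    = contradiction u<w (<-asym (Y-before-u y))
    ... | is-u refl = contradiction u<w (<-irrefl refl)
    ... | in-Z z    = z

    crossing-at-v : ∀ {a b} → Cross T σ (pos σ v) a b → X a × Y∪Z b
    crossing-at-v c@(a<v , v<b , _) with before-v⇒X a<v | after-v⇒Y∪Z-or-u v<b
    ... | x        | inj₁ yz   = x , yz
    ... | (au , _) | inj₂ refl = contradiction (Cross⇒E σ c) (E-asym T au)

    crossing-at-u : ∀ {a b} → Cross T σ (pos σ u) a b → X∪Y a × Z b
    crossing-at-u c@(a<u , u<b , _) with before-u⇒X∪Y-or-v a<u | after-u⇒Z u<b
    ... | inj₁ xy   | z        = xy , z
    ... | inj₂ refl | (_ , vb) = contradiction (Cross⇒E σ c) (E-asym T vb)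

  conditions⇒bridge : E T u v → B1 T u v × B2 T u v × B3 T u v → IsBridge T u v
  conditions⇒bridge uv (no-W , (in-v , in-u) , (out-v , out-u)) =
    let open BlockOrdering uv no-W
    in σ , v-before-u , inj₁ (v-before-u , uv) , u-only-v , v-only-u
         , noTwo⇒cutMatching σ crossing-at-u in-u out-u
         , noTwo⇒cutMatching σ crossing-at-v in-v out-v

proposition3p5 : ∀ {n : ℕ} (T : Tournament n) (u v : Fin n) → E T u v →
    (IsBridge T u v ⇔ (B1 T u v × B2 T u v × B3 T u v))
proposition3p5 T u v uv = mk⇔ (bridge⇒conditions T u v) (conditions⇒bridge T u v uv)
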